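{- Let $n\geq 2$, $q$ a prime power, $\mathcal{B}$ a non-degenerate symmetric bilinear form on $\mathbb{F}_q^n$, and $S\subset\mathbb{F}_q^n$ a $(3,2)$-orthogonal set with respect to $\mathcal{B}$. For $\bm{s}\in S$ let $S_{\bm{s}}=\{\bm{x}\in S\setminus\{\bm{s}\}:\mathcal{B}(\bm{x},\bm{s})\neq 0\}$. If $|S_{\bm{s}}|\geq 2$, then $S_{\bm{s}}$ is an orthogonal set. In particular, for every $\bm{s}\in S$ we may write $S_{\bm{s}}=R_{\bm{s}}\sqcup T_{\bm{s}}$, where $T_{\bm{s}}=\{\bm{x}\in S_{\bm{s}}:\mathcal{B}(\bm{x},\bm{x})\neq 0\}$ and $R_{\bm{s}}=S_{\bm{s}}\setminus T_{\bm{s}}$, and the span $V_{\bm{s}}=\langle R_{\bm{s}}\rangle$ is an orthogonal subspace of $\mathbb{F}_q^n$ that contains only self-orthogonal vectors (apart from $\bm{0}$).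
   Context: A bilinear form on $\mathbb{F}_q^n$ is $\mathcal{B}(\bm{x},\bm{y})=\bm{x}^TA\bm{y}$; symmetric means $A$ symmetric, non-degenerate means $\det A\neq0$. Nonzero $\bm{v}_1,\bm{v}_2$ are mutually orthogonal if $\mathcal{B}(\bm{v}_1,\bm{v}_2)=0$; a nonzero $\bm{v}$ is self-orthogonal if $\mathcal{B}(\bm{v},\bm{v})=0$. An orthogonal set is a subset of $\mathbb{F}_q^n\setminus\{\bm{0}\}$ whose distinct elements are pairwise mutually orthogonal; a subspace $V$ is an orthogonal subspace if $V\setminus\{\bm{0}\}$ is an orthogonal set. $S\subset\mathbb{F}_q^n\setminus\{\bm{0}\}$ is $(3,2)$-orthogonal if among any three distinct elements of $S$ at least two are mutually orthogonal. $\langle X\rangle$ denotes the linear span of $X$. -}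

module Defs where

open import Level using (Level; _⊔_)
open import Algebra.Bundles using (CommutativeRing)
open import Data.Nat as ℕ using (ℕ; zero; suc)
open import Data.Nat.Primality using (Prime)
open import Data.Fin using (Fin; punchIn)
import Data.Fin as Fin
open import Data.Product using (Σ; ∃; ∃₂; _×_; _,_; proj₁; proj₂)
open import Data.Sum using (_⊎_)
open import Data.List using (List; []; _∷_)
open import Data.List.Relation.Unary.All using (All)
open import Relation.Nullary using (¬_)
open import Relation.Binary.PropositionalEquality using (_≡_)

IsPrimePower : ℕ → Set
IsPrimePower q = ∃₂ λ p k → Prime p × 1 ℕ.≤ k × q ≡ p ℕ.^ k

record IsFiniteField {c ℓ} (F : CommutativeRing c ℓ) (q : ℕ) : Set (c ⊔ ℓ) where
  open CommutativeRing F
  field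
    0≉1       : ¬ (0# ≈ 1#)
    inverse   : ∀ x → ¬ (x ≈ 0#) → ∃ λ y → x * y ≈ 1#
    enum      : Fin q → Carrier
    enum-surj : ∀ x → ∃ λ i → enum i ≈ x
    enum-inj  : ∀ i j → enum i ≈ enum j → i ≡ j

module _ {c ℓ} (F : CommutativeRing c ℓ) where
  open CommutativeRing F

  Vec : ℕ → Set c
  Vec n = Fin n → Carrier

  Mat : ℕ → Set c
  Mat n = Fin n → Fin n → Carrier

  ∑ : (n : ℕ) → (Fin n → Carrier) → Carrier
  ∑ zero    f = 0#
  ∑ (suc n) f = f Fin.zero + ∑ n (λ i → f (Fin.suc i))

  Bil : ∀ {n} → Mat n → Vec n → Vec n → Carrier
  Bil {n} A x y = ∑ n (λ i → x i * ∑ n (λ j → A i j * y j))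

  sgn : ∀ {n} → Fin n → Carrier
  sgn Fin.zero    = 1#
  sgn (Fin.suc j) = - sgn j

  det : ∀ {n} → Mat n → Carrier
  det {zero}  A = 1#
  det {suc n} A = ∑ (suc n) (λ j → sgn j * (A Fin.zero j * det (λ i k → A (Fin.suc i) (punchIn j k))))

  Symmetric : ∀ {n} → Mat n → Set ℓ
  Symmetric A = ∀ i j → A i j ≈ A j i

  NonDegenerate : ∀ {n} → Mat n → Set ℓ
  NonDegenerate A = ¬ (det A ≈ 0#)

  _≈ᵥ_ : ∀ {n} → Vec n → Vec n → Set ℓ
  x ≈ᵥ y = ∀ i → x i ≈ y i

  0ᵥ : ∀ {n} → Vec n
  0ᵥ _ = 0#

  _+ᵥ_ : ∀ {n} → Vec n → Vec n → Vec n
  (x +ᵥ y) i = x i + y i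

  _·ᵥ_ : ∀ {n} → Carrier → Vec n → Vec n
  (a ·ᵥ x) i = a * x i

  module _ {n : ℕ} (A : Mat n) where

    OrthogonalSet : ∀ {p} → (Vec n → Set p) → Set (c ⊔ ℓ ⊔ p)
    OrthogonalSet S =
      (∀ x → S x → ¬ (x ≈ᵥ 0ᵥ)) ×
      (∀ x y → S x → S y → ¬ (x ≈ᵥ y) → Bil A x y ≈ 0#)

    ThreeTwoOrthogonal : ∀ {p} → (Vec n → Set p) → Set (c ⊔ ℓ ⊔ p)
    ThreeTwoOrthogonal S =
      (∀ x → S x → ¬ (x ≈ᵥ 0ᵥ)) ×
      (∀ x y z → S x → S y → S z →
         ¬ (x ≈ᵥ y) → ¬ (x ≈ᵥ z) → ¬ (y ≈ᵥ z) →
         Bil A x y ≈ 0# ⊎ Bil A x z ≈ 0# ⊎ Bil A y z ≈ 0#)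

    Sₛ : ∀ {p} → (Vec n → Set p) → Vec n → Vec n → Set (ℓ ⊔ p)
    Sₛ S s x = S x × ¬ (x ≈ᵥ s) × ¬ (Bil A x s ≈ 0#)

    Tₛ : ∀ {p} → (Vec n → Set p) → Vec n → Vec n → Set (ℓ ⊔ p)
    Tₛ S s x = Sₛ S s x × ¬ (Bil A x x ≈ 0#)

    Rₛ : ∀ {p} → (Vec n → Set p) → Vec n → Vec n → Set (ℓ ⊔ p)
    Rₛ S s x = Sₛ S s x × ¬ (Tₛ S s x)

    AtLeastTwo : ∀ {p} → (Vec n → Set p) → Set (c ⊔ ℓ ⊔ p)
    AtLeastTwo P = ∃₂ λ x y → P x × P y × ¬ (x ≈ᵥ y)

    linComb : List (Carrier × Vec n) → Vec n
    linComb []            = 0ᵥ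
    linComb ((a , v) ∷ l) = (a ·ᵥ v) +ᵥ linComb l

    Span : ∀ {p} → (Vec n → Set p) → Vec n → Set (c ⊔ ℓ ⊔ p)
    Span P v = ∃ λ (l : List (Carrier × Vec n)) → All (λ av → P (proj₂ av)) l × v ≈ᵥ linComb l

    IsSubspace : ∀ {p} → (Vec n → Set p) → Set (c ⊔ p)
    IsSubspace V =
      V 0ᵥ ×
      (∀ x y → V x → V y → V (x +ᵥ y)) ×
      (∀ a x → V x → V (a ·ᵥ x))

    NonzeroPart : ∀ {p} → (Vec n → Set p) → Vec n → Set (ℓ ⊔ p)
    NonzeroPart V x = V x × ¬ (x ≈ᵥ 0ᵥ)

    OrthogonalSubspace : ∀ {p} → (Vec n → Set p) → Set (c ⊔ ℓ ⊔ p)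
    OrthogonalSubspace V = IsSubspace V × OrthogonalSet (NonzeroPart V)

    OnlySelfOrthogonal : ∀ {p} → (Vec n → Set p) → Set (c ⊔ ℓ ⊔ p)
    OnlySelfOrthogonal V = ∀ v → V v → ¬ (v ≈ᵥ 0ᵥ) → Bil A v v ≈ 0#

-- Two elements of S_s are both non-orthogonal to s, so by (3,2)-orthogonality they are
-- orthogonal to each other. The elements of R_s are moreover self-orthogonal, so B vanishes
-- on R_s × R_s, and by bilinearity on ⟨R_s⟩ × ⟨R_s⟩. Finiteness of the field is used only
-- to make equality decidable: membership in R_s gives self-orthogonality merely up to double
-- negation.
module Submission where

open import Defs
open import Level using (Level; _⊔_)
open import Algebra.Bundles using (CommutativeRing)
open import Data.Nat using (ℕ; _≤_)
open import Data.Fin using (Fin; _≟_)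
open import Data.Product using (_×_; _,_; proj₁; proj₂; map₁)
open import Data.Sum using ([_,_]′)
open import Data.Empty using (⊥-elim)
open import Data.List using ([]; _∷_; _++_; map)
open import Data.List.Relation.Unary.All using (All; []; _∷_)
import Data.List.Relation.Unary.All.Properties as All
open import Data.Vec.Functional using (Vector)
open import Function using (id; _∘_)
open import Relation.Binary.Definitions using (Decidable)
import Relation.Binary.PropositionalEquality as ≡
open import Relation.Nullary using (¬_)
open import Relation.Nullary.Decidable using (map′; decidable-stable)
import Algebra.Properties.Semiring.Sum as SemiringSum
import Algebra.Properties.CommutativeSemigroup as CommutativeSemigroupProperties
import Data.Vec.Functional.Relation.Binary.Equality.Setoid as VectorEquality
import Relation.Binary.Reasoning.Setoid as SetoidReasoning

module _ {c ℓ} (F : CommutativeRing c ℓ) where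
  open CommutativeRing F
  open SemiringSum semiring using (sum; sum-cong-≋; sum-cong-≗; ∑-distrib-+; *-distribˡ-sum)
  open CommutativeSemigroupProperties *-commutativeSemigroup using (x∙yz≈y∙xz)
  open VectorEquality setoid using (_≋_; ≋-sym)
  open SetoidReasoning setoid

  ≈-dec : ∀ {q} → IsFiniteField F q → Decidable _≈_
  ≈-dec FF x y =
    let open IsFiniteField FF
        (i , eᵢ) = enum-surj x
        (j , eⱼ) = enum-surj y
    in map′ (λ i≡j → trans (sym eᵢ) (trans (reflexive (≡.cong enum i≡j)) eⱼ))
            (λ x≈y → enum-inj i j (trans eᵢ (trans x≈y (sym eⱼ))))
            (i ≟ j)

  ∑≡sum : ∀ m (f : Fin m → Carrier) → ∑ F m f ≡.≡ sum f
  ∑≡sum ℕ.zero    f = ≡.refl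
  ∑≡sum (ℕ.suc m) f = ≡.cong (f Fin.zero +_) (∑≡sum m (f ∘ Fin.suc))

  dot : ∀ {n} → Vector Carrier n → Vector Carrier n → Carrier
  dot u w = sum (λ i → u i * w i)

  _·ᴹ_ : ∀ {n} → Mat F n → Vec F n → Vec F n
  (A ·ᴹ y) i = dot (A i) y

  Bil≈dot : ∀ {n} (A : Mat F n) x y → Bil F A x y ≈ dot x (A ·ᴹ y)
  Bil≈dot {n} A x y = reflexive
    (≡.trans (∑≡sum n _) (sum-cong-≗ (λ i → ≡.cong (x i *_) (∑≡sum n _))))

  record IsLinear {n} (f : Vec F n → Carrier) : Set (c ⊔ ℓ) where
    field
      cong   : ∀ {u v} → u ≋ v → f u ≈ f v
      +-homo : ∀ u v → f (_+ᵥ_ F u v) ≈ f u + f v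
      ·-homo : ∀ a u → f (_·ᵥ_ F a u) ≈ a * f u

    0-homo : f (0ᵥ F) ≈ 0#
    0-homo = begin
      f (0ᵥ F)             ≈⟨ cong (λ _ → sym (zeroˡ 0#)) ⟩
      f (_·ᵥ_ F 0# (0ᵥ F)) ≈⟨ ·-homo 0# (0ᵥ F) ⟩
      0# * f (0ᵥ F)        ≈⟨ zeroˡ _ ⟩
      0#                   ∎

  IsLinear-resp : ∀ {n} {f g : Vec F n → Carrier} → (∀ u → f u ≈ g u) → IsLinear f → IsLinear g
  IsLinear-resp {f = f} {g} f≈g L = record
    { cong   = λ u≋v → transport (trans (cong u≋v) (f≈g _))
    ; +-homo = λ u v → transport (trans (+-homo u v) (+-cong (f≈g u) (f≈g v)))
    ; ·-homo = λ a u → transport (trans (·-homo a u) (*-congˡ (f≈g u)))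
    }
    where
    open IsLinear L
    transport : ∀ {u y} → f u ≈ y → g u ≈ y
    transport = trans (sym (f≈g _))

  dot-linearˡ : ∀ {n} (w : Vec F n) → IsLinear (λ u → dot u w)
  dot-linearˡ w = record
    { cong   = λ u≋v → sum-cong-≋ (λ i → *-congʳ (u≋v i))
    ; +-homo = λ u v → trans (sum-cong-≋ (λ i → distribʳ (w i) (u i) (v i)))
                         (∑-distrib-+ (λ i → u i * w i) (λ i → v i * w i))
    ; ·-homo = λ a u → trans (sum-cong-≋ (λ i → *-assoc a (u i) (w i)))
                         (sym (*-distribˡ-sum a (λ i → u i * w i)))
    }

  dot-linearʳ : ∀ {n} (u : Vec F n) → IsLinear (dot u)
  dot-linearʳ u = record
    { cong   = λ v≋w → sum-cong-≋ (λ i → *-congˡ (v≋w i))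
    ; +-homo = λ v w → trans (sum-cong-≋ (λ i → distribˡ (u i) (v i) (w i)))
                         (∑-distrib-+ (λ i → u i * v i) (λ i → u i * w i))
    ; ·-homo = λ a v → trans (sum-cong-≋ (λ i → x∙yz≈y∙xz (u i) a (v i)))
                         (sym (*-distribˡ-sum a (λ i → u i * v i)))
    }

  module _ {n : ℕ} (A : Mat F n) where

    Bil-linearˡ : ∀ y → IsLinear (λ x → Bil F A x y)
    Bil-linearˡ y = IsLinear-resp (λ x → sym (Bil≈dot A x y)) (dot-linearˡ (A ·ᴹ y))

    Bil-linearʳ : ∀ x → IsLinear (Bil F A x)
    Bil-linearʳ x = IsLinear-resp (λ y → sym (Bil≈dot A x y)) (record
      { cong   = λ v≋w → D.cong (λ i → IsLinear.cong (row i) v≋w)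
      ; +-homo = λ v w → trans (D.cong (λ i → IsLinear.+-homo (row i) v w)) (D.+-homo _ _)
      ; ·-homo = λ a v → trans (D.cong (λ i → IsLinear.·-homo (row i) a v)) (D.·-homo _ _)
      })
      where
      module D = IsLinear (dot-linearʳ x)
      row : ∀ i → IsLinear (λ y → (A ·ᴹ y) i)
      row i = dot-linearʳ (A i)

    linComb-++ : ∀ l m → linComb F A (l ++ m) ≋ _+ᵥ_ F (linComb F A l) (linComb F A m)
    linComb-++ []            m i = sym (+-identityˡ _)
    linComb-++ ((a , v) ∷ l) m i = trans (+-congˡ (linComb-++ l m i)) (sym (+-assoc _ _ _))

    linComb-scale : ∀ a l → _·ᵥ_ F a (linComb F A l) ≋ linComb F A (map (map₁ (a *_)) l)
    linComb-scale a []            i = zeroʳ a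
    linComb-scale a ((b , v) ∷ l) i =
      trans (distribˡ _ _ _) (+-cong (sym (*-assoc _ _ _)) (linComb-scale a l i))

    Span-isSubspace : ∀ {p} (P : Vec F n → Set p) → IsSubspace F A (Span F A P)
    Span-isSubspace P =
        ([] , [] , λ _ → refl)
      , (λ { x y (l , Pl , x≋l) (m , Pm , y≋m) →
             l ++ m , All.++⁺ Pl Pm ,
             λ i → trans (+-cong (x≋l i) (y≋m i)) (sym (linComb-++ l m i)) })
      , (λ { a x (l , Pl , x≋l) →
             map (map₁ (a *_)) l , All.map⁺ Pl ,
             λ i → trans (*-congˡ (x≋l i)) (linComb-scale a l i) })

    linear-vanishes-on-Span : ∀ {p} {P : Vec F n → Set p} {f} → IsLinear f →
                              (∀ v → P v → f v ≈ 0#) → ∀ v → Span F A P v → f v ≈ 0#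
    linear-vanishes-on-Span {P = P} {f} L f-P v (l , Pl , v≋l) = trans (cong v≋l) (on-linComb l Pl)
      where
      open IsLinear L
      on-linComb : ∀ l → All (λ av → P (proj₂ av)) l → f (linComb F A l) ≈ 0#
      on-linComb []            []        = 0-homo
      on-linComb ((a , u) ∷ l) (Pu ∷ Pl) = begin
        f (_+ᵥ_ F (_·ᵥ_ F a u) (linComb F A l)) ≈⟨ +-homo _ _ ⟩
        f (_·ᵥ_ F a u) + f (linComb F A l)     ≈⟨ +-cong (·-homo a u) (on-linComb l Pl) ⟩
        a * f u + 0#                           ≈⟨ +-identityʳ _ ⟩
        a * f u                                ≈⟨ *-congˡ (f-P u Pu) ⟩
        a * 0#                                 ≈⟨ zeroʳ a ⟩
        0#                                     ∎

    Pairwise-orthogonal : ∀ {p} → (Vec F n → Set p) → Set (c ⊔ ℓ ⊔ p)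
    Pairwise-orthogonal P = ∀ x y → P x → P y → Bil F A x y ≈ 0#

    Span-pairwise-orthogonal : ∀ {p} {P : Vec F n → Set p} →
                               Pairwise-orthogonal P → Pairwise-orthogonal (Span F A P)
    Span-pairwise-orthogonal {P = P} P⊥P x y ⟨P⟩x ⟨P⟩y =
      linear-vanishes-on-Span (Bil-linearˡ y) r⊥⟨P⟩ x ⟨P⟩x
      where
      r⊥⟨P⟩ : ∀ r → P r → Bil F A r y ≈ 0#
      r⊥⟨P⟩ r Pr = linear-vanishes-on-Span (Bil-linearʳ r) (λ r′ Pr′ → P⊥P r r′ Pr Pr′) y ⟨P⟩y

    Span-orthogonalSubspace : ∀ {p} {P : Vec F n → Set p} →
                              Pairwise-orthogonal P → OrthogonalSubspace F A (Span F A P)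
    Span-orthogonalSubspace {P = P} P⊥P =
        Span-isSubspace P
      , (λ _ → proj₂)
      , λ x y ⟨P⟩x ⟨P⟩y _ → Span-pairwise-orthogonal P⊥P x y (proj₁ ⟨P⟩x) (proj₁ ⟨P⟩y)

    Span-onlySelfOrthogonal : ∀ {p} {P : Vec F n → Set p} →
                              Pairwise-orthogonal P → OnlySelfOrthogonal F A (Span F A P)
    Span-onlySelfOrthogonal P⊥P v ⟨P⟩v _ = Span-pairwise-orthogonal P⊥P v v ⟨P⟩v ⟨P⟩v

    Sₛ-orthogonal : ∀ {p} {S : Vec F n → Set p} → ThreeTwoOrthogonal F A S →
                    ∀ {s} → S s → OrthogonalSet F A (Sₛ F A S s)
    Sₛ-orthogonal (nonzero , three-two) {s} Ss =
        (λ x Sₛx → nonzero x (proj₁ Sₛx))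
      , λ { x y (Sx , x≉s , Bxs≉0) (Sy , y≉s , Bys≉0) x≉y →
            [ id , [ ⊥-elim ∘ Bxs≉0 , ⊥-elim ∘ Bys≉0 ]′ ]′
              (three-two x y s Sx Sy Ss x≉y x≉s y≉s) }

    orthogonal-self-orthogonal⇒pairwise-orthogonal :
      Decidable _≈_ → ∀ {p} {P : Vec F n → Set p} →
      OrthogonalSet F A P → (∀ x → P x → ¬ ¬ (Bil F A x x ≈ 0#)) → Pairwise-orthogonal P
    orthogonal-self-orthogonal⇒pairwise-orthogonal _≟ᶠ_ (_ , P-orth) P-self x y Px Py =
      decidable-stable (Bil F A x y ≟ᶠ 0#) λ Bxy≉0 →
        P-self x Px λ Bxx≈0 →
          Bxy≉0 (P-orth x y Px Py λ x≋y →
            Bxy≉0 (trans (IsLinear.cong (Bil-linearʳ x) (≋-sym x≋y)) Bxx≈0))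

lemma3p5 : ∀ {c ℓ p : Level} (q : ℕ) → IsPrimePower q →
    (F : CommutativeRing c ℓ) → IsFiniteField F q →
    (n : ℕ) → 2 ≤ n →
    (A : Mat F n) → Symmetric F A → NonDegenerate F A →
    (S : Vec F n → Set p) → ThreeTwoOrthogonal F A S →
    ∀ s → S s →
      (AtLeastTwo F A (Sₛ F A S s) → OrthogonalSet F A (Sₛ F A S s)) ×
      OrthogonalSubspace F A (Span F A (Rₛ F A S s)) ×
      OnlySelfOrthogonal F A (Span F A (Rₛ F A S s))
lemma3p5 q _ F FF n _ A _ _ S S-32 s Ss =
  (λ _ → Sₛ⊥) , Span-orthogonalSubspace F A Rₛ⊥Rₛ , Span-onlySelfOrthogonal F A Rₛ⊥Rₛ
  where
  Sₛ⊥ : OrthogonalSet F A (Sₛ F A S s)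
  Sₛ⊥ = Sₛ-orthogonal F A S-32 Ss

  Rₛ⊥Rₛ : Pairwise-orthogonal F A (Rₛ F A S s)
  Rₛ⊥Rₛ = orthogonal-self-orthogonal⇒pairwise-orthogonal F A (≈-dec F FF)
    ((λ x Rx → proj₁ Sₛ⊥ x (proj₁ Rx)) , λ x y Rx Ry → proj₂ Sₛ⊥ x y (proj₁ Rx) (proj₁ Ry))
    (λ x Rx Bxx≉0 → proj₂ Rx (proj₁ Rx , Bxx≉0))
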